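{- Let $k\geq 3$ and $n_1,\dots,n_k\geq 2$. Let $V=V_1\sqcup\cdots\sqcup V_k$ be a labeled vertex set with $|V_i|=n_i$, and fix $w_i\in V_i$ for each $i$. Let $MR_{n_1,\dots,n_k}$ be the multi-leaf repeater graph on $V$: the vertices $w_1,\dots,w_k$ form a complete graph $K_k$, and each vertex of $V_i\setminus\{w_i\}$ is a leaf adjacent only to $w_i$. Let $K_{n_1,\dots,n_k}$ be the complete $k$-partite graph on $V$ with parts $V_1,\dots,V_k$, and for $r\in\{1,\dots,k\}$ let $CS^r_{n_1,\dots,n_k}$ be the clique-star on $V$ with cliques $V_1,\dots,V_k$ and center clique $V_r$. If $k$ is even, then $MR_{n_1,\dots,n_k}\in\mathcal{O}(K_{n_1,\dots,n_k})$. If $k$ is odd, then $MR_{n_1,\dots,n_k}\in\mathcal{O}(CS^r_{n_1,\dots,n_k})$.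
   Context: Local complement $c_v(G)$: replace the subgraph induced on the neighbourhood of vertex $v$ by its complement, leaving all other edges unchanged. The LC orbit $\mathcal{O}(G)$ is the set of labeled graphs on the vertex set of $G$ obtainable from $G$ by finite sequences of local complements. In the complete $k$-partite graph two vertices are adjacent iff they lie in different parts. In the clique-star $CS^r$ each $V_i$ is a clique, all vertices of $V_r$ are adjacent to all vertices of all $V_i$ ($i\ne r$), and there are no other edges. -}

module Defs where

open import Data.Nat using (ℕ)
open import Data.Fin using (Fin) renaming (_≟_ to _≟ᶠ_)
open import Data.Bool using (Bool; true; false; not; _∧_; _∨_; if_then_else_)
open import Data.Product using (Σ; ∃; _,_; proj₁; proj₂)
open import Data.Product.Properties using (≡-dec)
open import Data.List using (List; foldl)
open import Relation.Nullary.Decidable using (⌊_⌋)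
open import Relation.Binary.PropositionalEquality using (_≡_)
open import Relation.Binary.Definitions using (DecidableEquality)

Vertex : (k : ℕ) → (Fin k → ℕ) → Set
Vertex k n = Σ (Fin k) (λ i → Fin (n i))

eqF : {k : ℕ} → Fin k → Fin k → Bool
eqF i j = ⌊ i ≟ᶠ j ⌋

module _ {k : ℕ} {n : Fin k → ℕ} where

  _≟V_ : DecidableEquality (Vertex k n)
  _≟V_ = ≡-dec _≟ᶠ_ _≟ᶠ_

  eqV : Vertex k n → Vertex k n → Bool
  eqV x y = ⌊ x ≟V y ⌋


Graph : Set → Set
Graph V = V → V → Bool

module _ {k : ℕ} {n : Fin k → ℕ} where

  private V = Vertex k n

  lc : V → Graph V → Graph V
  lc v G x y =
    if G v x ∧ G v y ∧ not (eqV x y) ∧ not (eqV x v) ∧ not (eqV y v)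
    then not (G x y) else G x y

  lcSeq : List V → Graph V → Graph V
  lcSeq vs G = foldl (λ H v → lc v H) G vs

  _∈LCOrbit_ : Graph V → Graph V → Set
  H ∈LCOrbit G = ∃ λ (vs : List V) → ∀ x y → lcSeq vs G x y ≡ H x y

  MR : ((i : Fin k) → Fin (n i)) → Graph V
  MR w (i , a) (j , b) =
    if eqF i j
    then not (eqV (i , a) (j , b)) ∧ (⌊ a ≟ᶠ w i ⌋ ∨ ⌊ b ≟ᶠ w j ⌋)
    else ⌊ a ≟ᶠ w i ⌋ ∧ ⌊ b ≟ᶠ w j ⌋

  Kpart : Graph V
  Kpart (i , a) (j , b) = not (eqF i j)

  CS : Fin k → Graph V
  CS r (i , a) (j , b) =
    if eqF i j
    then not (eqV (i , a) (j , b))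
    else (eqF i r ∨ eqF j r)

-- Fix a centre part c and call wᵢ the hub of Vᵢ.  Consider the graphs in which V_c is a clique or
-- an independent set, and every other part is either a clique completely joined to V_c or a star
-- at its hub whose hub alone is joined to V_c.  Local complementation at the hub of a part of the
-- first kind turns it into one of the second kind and complements V_c.  Both CS^c and c_{w_c}(K)
-- are of this shape with all parts cliques (V_c a clique, resp. independent), so complementing at
-- the k − 1 other hubs makes every part a star, with V_c a clique exactly when k is odd, resp.
-- even.  A last local complementation at w_c then produces MR.

module Submission where

open import Defs
open import Data.Bool using (Bool; true; false; not; _∧_; _∨_; if_then_else_)
open import Data.Bool.Properties using (not-involutive; ∨-zeroʳ; ∧-identityʳ; ∧-zeroʳ)
open import Data.Fin using (Fin; zero; punchIn; punchOut) renaming (_≟_ to _≟ᶠ_)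
open import Data.Fin.Properties using (punchIn-injective; punchInᵢ≢i; punchIn-punchOut)
open import Data.List using (List; []; _∷_; _++_; length; tabulate)
open import Data.List.Properties using (foldl-++; length-tabulate)
open import Data.List.Membership.Propositional using (_∈_)
open import Data.List.Membership.Propositional.Properties using (∈-tabulate⁺)
open import Data.List.Relation.Unary.All using (All; []; _∷_)
open import Data.List.Relation.Unary.All.Properties using () renaming (tabulate⁺ to All-tabulate⁺)
open import Data.List.Relation.Unary.Any using (here; there)
open import Data.List.Relation.Unary.Unique.Propositional using (Unique; []; _∷_)
open import Data.List.Relation.Unary.Unique.Propositional.Properties using () renaming (tabulate⁺ to Unique-tabulate⁺)
open import Data.Nat using (ℕ; suc; _≤_; _%_)
open import Data.Nat.GeneralisedArithmetic using (iterate)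
open import Data.Product using (_×_; _,_)
open import Function using (_∘_)
open import Relation.Binary.Definitions using (DecidableEquality)
open import Relation.Binary.PropositionalEquality
open import Relation.Nullary using (yes; no; contradiction)
open import Relation.Nullary.Decidable using (⌊_⌋)

≟-refl : ∀ {m} (i : Fin m) → (i ≟ᶠ i) ≡ yes refl
≟-refl i = ≡-≟-identity _≟ᶠ_ refl

≟-≢ : ∀ {m} {i j : Fin m} (i≢j : i ≢ j) → (i ≟ᶠ j) ≡ no i≢j
≟-≢ = ≢-≟-identity _≟ᶠ_

⌊≟⌋-sym : ∀ {A : Set} (_≟_ : DecidableEquality A) x y → ⌊ x ≟ y ⌋ ≡ ⌊ y ≟ x ⌋
⌊≟⌋-sym _≟_ x y with x ≟ y | y ≟ x
... | yes refl | yes _    = refl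
... | yes refl | no y≢x   = contradiction refl y≢x
... | no x≢y   | yes refl = contradiction refl x≢y
... | no _     | no _     = refl

iterate-not-even : ∀ m b → m % 2 ≡ 0 → iterate not b m ≡ b
iterate-not-even 0             b _    = refl
iterate-not-even (suc (suc m)) b even rewrite not-involutive b = iterate-not-even m b even

iterate-not-odd : ∀ m b → m % 2 ≡ 1 → iterate not b m ≡ not b
iterate-not-odd 1             b _   = refl
iterate-not-odd (suc (suc m)) b odd rewrite not-involutive b = iterate-not-odd m b odd

_∈ᵇ_ : ∀ {m} → Fin m → List (Fin m) → Bool
i ∈ᵇ []       = false
i ∈ᵇ (j ∷ js) = eqF j i ∨ i ∈ᵇ js

∈⇒∈ᵇ : ∀ {m} {i : Fin m} {js} → i ∈ js → i ∈ᵇ js ≡ true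
∈⇒∈ᵇ {i = i} (here refl) rewrite ≟-refl i = refl
∈⇒∈ᵇ {i = i} {j ∷ _} (there i∈js) rewrite ∈⇒∈ᵇ i∈js = ∨-zeroʳ (eqF j i)

∉⇒∈ᵇ : ∀ {m} {i : Fin m} {js} → All (i ≢_) js → i ∈ᵇ js ≡ false
∉⇒∈ᵇ []             = refl
∉⇒∈ᵇ (i≢j ∷ i∉js) rewrite ≟-≢ (i≢j ∘ sym) = ∉⇒∈ᵇ i∉js

others : ∀ {m} → Fin (suc m) → List (Fin (suc m))
others c = tabulate (punchIn c)

others-unique : ∀ {m} (c : Fin (suc m)) → Unique (others c)
others-unique c = Unique-tabulate⁺ (punchIn-injective c _ _)

others-≢ : ∀ {m} (c : Fin (suc m)) → All (_≢ c) (others c)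
others-≢ c = All-tabulate⁺ (punchInᵢ≢i c)

∈ᵇ-others : ∀ {m} {c : Fin (suc m)} i → i ≢ c → i ∈ᵇ others c ≡ true
∈ᵇ-others {c = c} i i≢c =
  ∈⇒∈ᵇ (subst (_∈ others c) (punchIn-punchOut c≢i) (∈-tabulate⁺ (punchOut c≢i)))
  where c≢i = i≢c ∘ sym

module _ {k : ℕ} {n : Fin k → ℕ} where

  private
    V = Vertex k n

  _≈ᴳ_ : Graph V → Graph V → Set
  G ≈ᴳ H = ∀ x y → G x y ≡ H x y

  lc-cong : ∀ {G H} v → G ≈ᴳ H → lc v G ≈ᴳ lc v H
  lc-cong v G≈H x y rewrite G≈H v x | G≈H v y | G≈H x y = refl

  lcSeq-cong : ∀ {G H} vs → G ≈ᴳ H → lcSeq vs G ≈ᴳ lcSeq vs H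
  lcSeq-cong []       G≈H = G≈H
  lcSeq-cong (v ∷ vs) G≈H = lcSeq-cong vs (lc-cong v G≈H)

  ≈ᴳ⇒∈LCOrbit : ∀ {G H} → G ≈ᴳ H → H ∈LCOrbit G
  ≈ᴳ⇒∈LCOrbit G≈H = [] , G≈H

  lc-∈LCOrbit : ∀ {G H} v → lc v G ≈ᴳ H → H ∈LCOrbit G
  lc-∈LCOrbit v lcG≈H = v ∷ [] , lcG≈H

  ∈LCOrbit-trans : ∀ {G H K} → H ∈LCOrbit G → K ∈LCOrbit H → K ∈LCOrbit G
  ∈LCOrbit-trans {G} {H} {K} (vs , G↝H) (us , H↝K) = vs ++ us , λ x y → begin
    lcSeq (vs ++ us) G x y    ≡⟨ cong (λ F → F x y) (foldl-++ (λ F v → lc v F) G vs us) ⟩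
    lcSeq us (lcSeq vs G) x y ≡⟨ lcSeq-cong us G↝H x y ⟩
    lcSeq us H x y            ≡⟨ H↝K x y ⟩
    K x y                     ∎
    where open ≡-Reasoning

  -- Local complementation without the guards x ≢ v and y ≢ v, which are redundant when v has no loop.
  lc′ : V → Graph V → Graph V
  lc′ v G x y = if G v x ∧ G v y ∧ not (eqV x y) then not (G x y) else G x y

  lc≈lc′ : ∀ G v → G v v ≡ false → lc v G ≈ᴳ lc′ v G
  lc≈lc′ G v Gvv≡false x y with x ≟V v | y ≟V v
  ... | yes refl | _        rewrite Gvv≡false = refl
  ... | no _     | yes refl rewrite Gvv≡false = refl
  ... | no _     | no _     rewrite ∧-identityʳ (not (eqV x y)) = refl

module _ {k : ℕ} {n : Fin k → ℕ} (w : (i : Fin k) → Fin (n i)) where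

  private
    V = Vertex k n

  hub : Fin k → V
  hub i = i , w i

  isHub : V → Bool
  isHub (i , a) = eqF (w i) a

  -- centre: V_c is a clique (else independent).  full i: V_i is a clique completely joined to V_c
  -- (else a star at its hub, whose hub alone is joined to V_c).
  Hybrid : Fin k → (Fin k → Bool) → Bool → Graph V
  Hybrid c full centre x@(i , _) y@(l , _) =
    if eqF i l then not (eqV x y) ∧ (if eqF i c then centre else full i ∨ isHub x ∨ isHub y)
    else if eqF i c then full l ∨ isHub y
    else if eqF l c then full i ∨ isHub x
    else false

  Hybrid-irreflexive : ∀ c full centre x → Hybrid c full centre x x ≡ false
  Hybrid-irreflexive c full centre (i , a) rewrite ≟-refl i | ≟-refl a = refl

  lc≈lc′-Hybrid : ∀ c full centre v → lc v (Hybrid c full centre) ≈ᴳ lc′ v (Hybrid c full centre)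
  lc≈lc′-Hybrid c full centre v = lc≈lc′ (Hybrid c full centre) v (Hybrid-irreflexive c full centre v)

  module _ (c : Fin k) where

    CS≈Hybrid : ∀ {full} → (∀ i → i ≢ c → full i ≡ true) →
                CS c ≈ᴳ Hybrid c full true
    CS≈Hybrid full≡true (i , a) (l , b) with i ≟ᶠ l | i ≟ᶠ c | l ≟ᶠ c
    ... | yes refl | yes refl | _        = sym (∧-identityʳ _)
    ... | yes refl | no i≢c   | _        rewrite full≡true i i≢c = sym (∧-identityʳ _)
    ... | no i≢l   | yes refl | _        rewrite full≡true l (i≢l ∘ sym) = refl
    ... | no _     | no i≢c   | yes refl rewrite full≡true i i≢c = refl
    ... | no _     | no _     | no _     = refl

    lc-hub-Kpart : ∀ {full} → (∀ i → i ≢ c → full i ≡ true) →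
                   lc (hub c) Kpart ≈ᴳ Hybrid c full false
    lc-hub-Kpart full≡true (i , a) (l , b) with i ≟ᶠ c | l ≟ᶠ c
    ... | yes refl | yes refl rewrite ≟-refl c = sym (∧-zeroʳ _)
    ... | yes refl | no l≢c   rewrite ≟-refl c | ≟-≢ (l≢c ∘ sym) | full≡true l l≢c = refl
    ... | no i≢c   | yes refl
      rewrite ≟-refl c | ≟-≢ i≢c | ≟-≢ (i≢c ∘ sym) | full≡true i i≢c = refl
    ... | no i≢c   | no l≢c
      rewrite ≟-≢ (i≢c ∘ sym) | ≟-≢ (l≢c ∘ sym) | full≡true i i≢c with i ≟ᶠ l
    ...   | no _     = refl
    ...   | yes refl with a ≟ᶠ b
    ...     | yes _ = refl
    ...     | no _  = refl

    lc′-hub-Hybrid-centre : lc′ (hub c) (Hybrid c (λ _ → false) true) ≈ᴳ MR w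
    lc′-hub-Hybrid-centre (i , a) (l , b) with i ≟ᶠ c | l ≟ᶠ c
    lc′-hub-Hybrid-centre (_ , a) (_ , b) | yes refl | yes refl
      rewrite ≟-refl c | ⌊≟⌋-sym _≟ᶠ_ a (w c) | ⌊≟⌋-sym _≟ᶠ_ b (w c)
      with w c ≟ᶠ a | w c ≟ᶠ b | a ≟ᶠ b
    ... | yes _ | _     | _     = refl
    ... | no _  | yes _ | _     = refl
    ... | no _  | no _  | yes _ = refl
    ... | no _  | no _  | no _  = refl
    lc′-hub-Hybrid-centre (_ , a) (l , b) | yes refl | no l≢c
      rewrite ≟-refl c | ≟-≢ (l≢c ∘ sym) | ⌊≟⌋-sym _≟ᶠ_ a (w c) | ⌊≟⌋-sym _≟ᶠ_ b (w l)
      with w c ≟ᶠ a | w l ≟ᶠ b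
    ... | yes _ | yes _ = refl
    ... | yes _ | no _  = refl
    ... | no _  | yes _ = refl
    ... | no _  | no _  = refl
    lc′-hub-Hybrid-centre (i , a) (_ , b) | no i≢c | yes refl
      rewrite ≟-refl c | ≟-≢ i≢c | ≟-≢ (i≢c ∘ sym)
            | ⌊≟⌋-sym _≟ᶠ_ a (w i) | ⌊≟⌋-sym _≟ᶠ_ b (w c)
      with w i ≟ᶠ a | w c ≟ᶠ b
    ... | yes _ | yes _ = refl
    ... | yes _ | no _  = refl
    ... | no _  | yes _ = refl
    ... | no _  | no _  = refl
    lc′-hub-Hybrid-centre (i , a) (l , b) | no i≢c | no l≢c
      rewrite ≟-refl c | ≟-≢ (i≢c ∘ sym) | ≟-≢ (l≢c ∘ sym)
            | ⌊≟⌋-sym _≟ᶠ_ a (w i) | ⌊≟⌋-sym _≟ᶠ_ b (w l)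
      with i ≟ᶠ l | w i ≟ᶠ a | w l ≟ᶠ b
    ... | no _     | no _     | _        = refl
    ... | no _     | yes _    | no _     = refl
    ... | no _     | yes _    | yes _    = refl
    ... | yes refl | no _     | _        = refl
    ... | yes refl | yes _    | no _     = refl
    ... | yes refl | yes refl | yes refl rewrite ≟-refl (w i) = refl

    lc-hub-Hybrid-centre : lc (hub c) (Hybrid c (λ _ → false) true) ≈ᴳ MR w
    lc-hub-Hybrid-centre x y =
      trans (lc≈lc′-Hybrid c (λ _ → false) true (hub c) x y) (lc′-hub-Hybrid-centre x y)

  module _ {c j : Fin k} {full : Fin k → Bool} {centre : Bool}
           (j≢c : j ≢ c) (fullⱼ : full j ≡ false) where

    private
      data Region : Fin k → Set where
        pivot       : Region j
        centre-part : Region c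
        elsewhere   : ∀ {i} → j ≢ i → i ≢ c → Region i

      region : ∀ i → Region i
      region i with j ≟ᶠ i | i ≟ᶠ c
      ... | yes refl | yes refl = contradiction refl j≢c
      ... | yes refl | no _     = pivot
      ... | no _     | yes refl = centre-part
      ... | no j≢i   | no i≢c   = elsewhere j≢i i≢c

    lc′-hub-Hybrid : lc′ (hub j) (Hybrid c (λ i → eqF j i ∨ full i) centre) ≈ᴳ
                     Hybrid c full (not centre)
    lc′-hub-Hybrid (i , a) (l , b) with region i | region l
    lc′-hub-Hybrid (_ , a) (_ , b) | pivot | pivot
      rewrite ≟-refl j | ≟-≢ j≢c | fullⱼ with w j ≟ᶠ a | w j ≟ᶠ b | a ≟ᶠ b
    ... | yes _ | _     | _     = refl
    ... | no _  | yes _ | _     = refl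
    ... | no _  | no _  | yes _ = refl
    ... | no _  | no _  | no _  = refl
    lc′-hub-Hybrid (_ , a) (_ , b) | pivot | centre-part
      rewrite ≟-refl j | ≟-refl c | ≟-≢ j≢c | fullⱼ with w j ≟ᶠ a
    ... | yes _ = refl
    ... | no _  = refl
    lc′-hub-Hybrid (_ , a) (_ , b) | pivot | elsewhere j≢l l≢c
      rewrite ≟-refl j | ≟-≢ j≢c | ≟-≢ j≢l | ≟-≢ l≢c with w j ≟ᶠ a
    ... | yes _ = refl
    ... | no _  = refl
    lc′-hub-Hybrid (_ , a) (_ , b) | centre-part | pivot
      rewrite ≟-refl j | ≟-refl c | ≟-≢ j≢c | ≟-≢ (j≢c ∘ sym) | fullⱼ with w j ≟ᶠ b
    ... | yes _ = refl
    ... | no _  = refl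
    lc′-hub-Hybrid (_ , a) (_ , b) | centre-part | centre-part
      rewrite ≟-refl j | ≟-refl c | ≟-≢ j≢c with a ≟ᶠ b
    ... | yes _ = refl
    ... | no _  = refl
    lc′-hub-Hybrid (_ , a) (_ , b) | centre-part | elsewhere j≢l l≢c
      rewrite ≟-refl j | ≟-refl c | ≟-≢ j≢c | ≟-≢ j≢l | ≟-≢ l≢c | ≟-≢ (l≢c ∘ sym) = refl
    lc′-hub-Hybrid (_ , a) (_ , b) | elsewhere j≢i i≢c | pivot
      rewrite ≟-≢ j≢c | ≟-≢ j≢i | ≟-≢ i≢c | ≟-≢ (j≢i ∘ sym) = refl
    lc′-hub-Hybrid (_ , a) (_ , b) | elsewhere j≢i i≢c | centre-part
      rewrite ≟-refl c | ≟-≢ j≢c | ≟-≢ j≢i | ≟-≢ i≢c = refl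
    lc′-hub-Hybrid (_ , a) (_ , b) | elsewhere j≢i i≢c | elsewhere j≢l l≢c
      rewrite ≟-≢ j≢c | ≟-≢ j≢i | ≟-≢ j≢l | ≟-≢ i≢c | ≟-≢ l≢c = refl

    lc-hub-Hybrid : lc (hub j) (Hybrid c (λ i → eqF j i ∨ full i) centre) ≈ᴳ
                    Hybrid c full (not centre)
    lc-hub-Hybrid x y =
      trans (lc≈lc′-Hybrid c (λ i → eqF j i ∨ full i) centre (hub j) x y) (lc′-hub-Hybrid x y)

  Hybrid-∅-∈LCOrbit : ∀ {c} js → Unique js → All (_≢ c) js → ∀ centre →
                      Hybrid c (λ _ → false) (iterate not centre (length js))
                        ∈LCOrbit Hybrid c (_∈ᵇ js) centre
  Hybrid-∅-∈LCOrbit []       _                   _              centre = ≈ᴳ⇒∈LCOrbit (λ _ _ → refl)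
  Hybrid-∅-∈LCOrbit (j ∷ js) (j∉js ∷ js-unique) (j≢c ∷ js≢c) centre =
    ∈LCOrbit-trans (lc-∈LCOrbit (hub j) (lc-hub-Hybrid j≢c (∉⇒∈ᵇ j∉js)))
                   (Hybrid-∅-∈LCOrbit js js-unique js≢c (not centre))

module _ {m : ℕ} {n : Fin (suc m) → ℕ} (w : (i : Fin (suc m)) → Fin (n i)) where

  MR-∈LCOrbit-Hybrid : ∀ c centre → iterate not centre m ≡ true →
                       MR w ∈LCOrbit Hybrid w c (_∈ᵇ others c) centre
  MR-∈LCOrbit-Hybrid c centre flips≡true =
    ∈LCOrbit-trans all-stars (lc-∈LCOrbit (hub w c) (lc-hub-Hybrid-centre w c))
    where
    all-stars : Hybrid w c (λ _ → false) true ∈LCOrbit Hybrid w c (_∈ᵇ others c) centre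
    all-stars = subst (λ b → Hybrid w c (λ _ → false) b ∈LCOrbit Hybrid w c (_∈ᵇ others c) centre)
                      (trans (cong (iterate not centre) (length-tabulate (punchIn c))) flips≡true)
                      (Hybrid-∅-∈LCOrbit w (others c) (others-unique c) (others-≢ c) centre)

theorem9 : (k : ℕ) → 3 ≤ k → (n : Fin k → ℕ) → (∀ i → 2 ≤ n i)
    → (w : (i : Fin k) → Fin (n i))
    → (k % 2 ≡ 0 → MR {k} {n} w ∈LCOrbit Kpart)
      × (k % 2 ≡ 1 → (r : Fin k) → MR {k} {n} w ∈LCOrbit CS r)
theorem9 (suc m) _ n _ w = even , odd
  where
  -- iterate not b (suc m) unfolds to iterate not (not b) m.
  even : suc m % 2 ≡ 0 → MR w ∈LCOrbit Kpart
  even k-even = ∈LCOrbit-trans (lc-∈LCOrbit (hub w zero) (lc-hub-Kpart w zero ∈ᵇ-others))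
                               (MR-∈LCOrbit-Hybrid w zero false (iterate-not-even (suc m) true k-even))
  odd : suc m % 2 ≡ 1 → (r : Fin (suc m)) → MR w ∈LCOrbit CS r
  odd k-odd r = ∈LCOrbit-trans (≈ᴳ⇒∈LCOrbit (CS≈Hybrid w r ∈ᵇ-others))
                               (MR-∈LCOrbit-Hybrid w r true (iterate-not-odd (suc m) false k-odd))
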